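{- In the setting described in the context, let $k\geq 0$ be an integer and let $B^*\subseteq B_v$ and $\mathcal{A}^*\subseteq\mathcal{A}$ be such that $\widehat{H}$ contains a $(k+2)$-expansion of $B^*$ into $\mathcal{A}^*$. Then every set $S\subseteq V(G)$ with $|S|\leq k$, $v\notin S$ and $G\setminus S$ chordal contains all vertices of $B^*$.
   Context: Let $G$ be a finite simple undirected graph; a chordless cycle is an induced cycle on at least four vertices, and a graph is chordal if it has none. Let $E_I,E_M\subseteq E(G)$ and for $u\in V(G)$ let $N^R_G(u)=\{w\in N_G(u):\{u,w\}\notin E_I\cup E_M\}$. Fix $v\in V(G)$ and a set $B_v\subseteq V(G)\setminus\{v\}$ such that $G\setminus B_v$ is chordal. Let $I$ be an independent set of $G$ with $I\subseteq N^R_G(v)\setminus B_v$. Let $X=N_G(v)\setminus(B_v\cup I)$, let $H=G\setminus(\{v\}\cup B_v\cup X)$, and let $\mathcal{A}$ be the set of connected components of $H$ that contain at least one vertex of $I$. Each $A\in\mathcal{A}$ contains exactly one vertex of $I$, denoted $z(A)$. For a vertex set $U$, $N_G(U)=\bigcup_{u\in U}N_G(u)$. Let $B_c=B_v\cap N_G(v)$ and $B_f=B_v\setminus B_c$. The bipartite graph $\widehat{H}$ has vertex set $\mathcal{A}\cup B_v$ (each component $A$ is a single vertex); for $b\in B_c$ and $A\in\mathcal{A}$, $\{b,A\}\in E(\widehat{H})$ iff $b\in N_G(V(A))\setminus N_G(z(A))$; for $b\in B_f$ and $A\in\mathcal{A}$, $\{b,A\}\in E(\widehat{H})$ iff $b\in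 N_G(V(A))$. For a bipartite graph with sides $P,Q$ and a positive integer $c$, a $c$-expansion of $P'\subseteq P$ into $Q'\subseteq Q$ is a set $M$ of edges between $P'$ and $Q'$ such that every vertex of $P'$ is incident to exactly $c$ edges of $M$ and $M$ saturates exactly $c|P'|$ vertices of $Q'$ (so the edges of $M$ form vertex-disjoint $c$-stars centered at the vertices of $P'$). -}

module Defs where

open import Data.Nat using (ℕ; zero; suc; _≤_; _+_)
open import Data.Fin using (Fin; toℕ)
open import Data.Fin.Subset using (Subset; _∈_; _∉_)
open import Data.Product using (Σ; _×_; ∃; ∃-syntax)
open import Data.Sum using (_⊎_)
open import Data.Empty using (⊥)
open import Relation.Nullary using (¬_; Dec)
open import Relation.Binary.PropositionalEquality using (_≡_; _≢_)

record Graph (n : ℕ) : Set₁ where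
  field
    Adj     : Fin n → Fin n → Set
    adj-dec : ∀ u w → Dec (Adj u w)
    sym     : ∀ {u w} → Adj u w → Adj w u
    irrefl  : ∀ {u} → ¬ Adj u u

open Graph public

VPred : ℕ → Set₁
VPred n = Fin n → Set

CycAdj : (m : ℕ) → Fin m → Fin m → Set
CycAdj m i j =
    (toℕ j ≡ suc (toℕ i))
  ⊎ (toℕ i ≡ suc (toℕ j))
  ⊎ (toℕ i ≡ 0 × suc (toℕ j) ≡ m)
  ⊎ (toℕ j ≡ 0 × suc (toℕ i) ≡ m)

record ChordlessCycle {n : ℕ} (G : Graph n) (X : VPred n) : Set where
  field
    len      : ℕ
    len≥4    : 4 ≤ len
    vert     : Fin len → Fin n
    inj      : ∀ i j → vert i ≡ vert j → i ≡ j
    inside   : ∀ i → X (vert i)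
    edges    : ∀ i j → CycAdj len i j → Adj G (vert i) (vert j)
    chordless : ∀ i j → Adj G (vert i) (vert j) → CycAdj len i j

ChordalOn : {n : ℕ} → Graph n → VPred n → Set
ChordalOn G X = ¬ ChordlessCycle G X

ChordalMinus : {n : ℕ} → Graph n → Subset n → Set
ChordalMinus G S = ChordalOn G (λ u → u ∉ S)

data Reach {n : ℕ} (G : Graph n) (X : VPred n) : Fin n → Fin n → Set where
  here : ∀ {u} → X u → Reach G X u u
  step : ∀ {u w x} → X u → Adj G u w → Reach G X w x → Reach G X u x

record IsComponent {n : ℕ} (G : Graph n) (X : VPred n) (A : Subset n) : Set where
  field
    nonempty  : ∃[ a ] a ∈ A
    inX       : ∀ {a} → a ∈ A → X a
    connected : ∀ {a b} → a ∈ A → b ∈ A → Reach G X a b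
    closed    : ∀ {a w} → a ∈ A → X w → Adj G a w → w ∈ A

module Setting {n : ℕ} (G : Graph n)
  (EI EM : Fin n → Fin n → Set)
  (v : Fin n) (Bv I : Subset n) where

  -- {u,w} ∈ E_I ∪ E_M  (unordered pair)
  InEIM : Fin n → Fin n → Set
  InEIM u w = EI u w ⊎ EI w u ⊎ EM u w ⊎ EM w u

  NR : Fin n → Fin n → Set
  NR u w = Adj G u w × ¬ InEIM u w

  Xset : VPred n
  Xset u = Adj G v u × u ∉ Bv × u ∉ I

  Hset : VPred n
  Hset u = u ≢ v × u ∉ Bv × ¬ Xset u

  InCalA : Subset n → Set
  InCalA A = IsComponent G Hset A × (∃[ z ] (z ∈ A × z ∈ I))

  InBc : VPred n
  InBc b = b ∈ Bv × Adj G v b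

  InBf : VPred n
  InBf b = b ∈ Bv × ¬ Adj G v b

  NbOfSet : Fin n → Subset n → Set
  NbOfSet b A = ∃[ a ] (a ∈ A × Adj G a b)

  -- edges of the bipartite graph Ĥ between b ∈ B_v and A ∈ 𝒜.
  -- z(A) is the unique vertex of A ∩ I, so "b ∉ N_G(z(A))" is
  -- stated as "b is adjacent to no vertex of A ∩ I".
  HatEdge : Fin n → Subset n → Set
  HatEdge b A =
      (InBc b × NbOfSet b A × (∀ z → z ∈ A → z ∈ I → ¬ Adj G z b))
    ⊎ (InBf b × NbOfSet b A)

-- c-expansions in a bipartite graph with sides P (vertices of type Fin n,
-- here B_v) and Q (vertex sets, here components), given as vertex-disjoint
-- c-stars: each p ∈ P' gets c distinct neighbours in Q', and different
-- p's get disjoint sets of neighbours.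

record Expansion {n : ℕ} (c : ℕ) (E : Fin n → Subset n → Set)
                 (P' : Subset n) (Q' : Subset n → Set) : Set where
  field
    star     : (p : Fin n) → p ∈ P' → Fin c → Subset n
    star-Q   : ∀ p (h : p ∈ P') i → Q' (star p h i)
    star-E   : ∀ p (h : p ∈ P') i → E p (star p h i)
    star-inj : ∀ p (h : p ∈ P') i q (h' : q ∈ P') j →
               star p h i ≡ star q h' j → (p ≡ q × i ≡ j)

module Submission where

open import Defs
open import Data.Nat as ℕ using (ℕ; suc; _≤_; _<_; _+_; z≤n; s≤s)
open import Data.Nat.Properties using (≤-trans; <⇒≱; m<n⇒m<1+n; m≤n+m; ≤-reflexive; +-comm) renaming (suc-injective to ℕ-suc-injective)
open import Data.Fin using (Fin; zero; suc; toℕ; punchIn)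
open import Data.Fin.Properties using (0≢1+n; punchIn-injective; punchInᵢ≢i) renaming (suc-injective to Fin-suc-injective; any? to ∃?)
open import Data.Fin.Subset using (Subset; _∈_; _∉_; _⊆_; ∣_∣; _∩_; _-_; Nonempty; Empty)
open import Data.Fin.Subset.Properties using (_∈?_; nonempty?; ⊆-antisym; x∈p∩q⁺; x∈p∩q⁻; x∈p∧x≢y⇒x∈p-y; x∈p⇒∣p-x∣<∣p∣)
open import Data.List using (List; []; _∷_; _++_; [_]; length; lookup)
open import Data.List.Properties using (++-assoc; length-++)
open import Data.List.Relation.Unary.All as All using (All; []; _∷_)
open import Data.List.Relation.Unary.All.Properties using (++⁺; ++⁻ˡ; ++⁻ʳ; ¬Any⇒All¬)
open import Data.List.Relation.Unary.Any as Any using (Any; here; there)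
open import Data.List.Membership.Propositional.Properties using (∈-lookup)
open import Data.Product using (_×_; _,_; proj₁; proj₂; ∃-syntax; ∃₂)
open import Data.Sum using (_⊎_; inj₁; inj₂; [_,_]′; swap) renaming (map to ⊎-map)
open import Data.Empty using (⊥; ⊥-elim)
open import Data.Unit using (⊤; tt)
open import Function using (_∘_)
open import Function.Bundles using (_⇔_; mk⇔; Equivalence)
open import Function.Definitions using (Injective)
open import Function.Properties.Equivalence using () renaming (trans to ⇔-trans; sym to ⇔-sym)
open import Relation.Nullary using (¬_; ¬?; yes; no; contradiction)
open import Relation.Nullary.Decidable using (decidable-stable)
open import Relation.Unary using (Decidable)
open import Relation.Binary.PropositionalEquality using (_≡_; _≢_; refl; cong; subst; ≢-sym) renaming (sym to ≡-sym)

-- Suppose a centre b of the expansion survives in G ∖ S.  Its k + 2 stars are distinct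
-- components of H, and |S| ≤ k leaves two of them, A₀ and A₁, disjoint from S.  Walking
-- inside a component from its vertex z(A) ∈ N(v) to a neighbour of b and shortcutting
-- yields an induced path from N(b) to N(v).  If b ∈ B_c, the path through A₀ closes with
-- b and v into a chordless cycle (it has an inner vertex, since a vertex of H adjacent to
-- v lies in I and b misses z(A₀)); if b ∈ B_f, the paths through A₀ and A₁ are joined at
-- b and closed at v.  Either cycle avoids S, contradicting the chordality of G ∖ S.

⇔-⊥ : {A B : Set} → ¬ A → ¬ B → A ⇔ B
⇔-⊥ ¬a ¬b = mk⇔ (⊥-elim ∘ ¬a) (⊥-elim ∘ ¬b)

Consecutive : ∀ {m} → Fin m → Fin m → Set
Consecutive i j = toℕ j ≡ suc (toℕ i) ⊎ toℕ i ≡ suc (toℕ j)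

consecutive-suc : ∀ {m} {i j : Fin m} → Consecutive (suc i) (suc j) ⇔ Consecutive i j
consecutive-suc = mk⇔ (⊎-map ℕ-suc-injective ℕ-suc-injective) (⊎-map (cong ℕ.suc) (cong ℕ.suc))

cycAdj-sym : ∀ {m} {i j : Fin m} → CycAdj m i j → CycAdj m j i
cycAdj-sym (inj₁ e)               = inj₂ (inj₁ e)
cycAdj-sym (inj₂ (inj₁ e))        = inj₁ e
cycAdj-sym (inj₂ (inj₂ (inj₁ e))) = inj₂ (inj₂ (inj₂ e))
cycAdj-sym (inj₂ (inj₂ (inj₂ e))) = inj₂ (inj₂ (inj₁ e))

¬cycAdj-zero-zero : ∀ {m} → ¬ CycAdj (suc (suc m)) zero zero
¬cycAdj-zero-zero (inj₁ ())
¬cycAdj-zero-zero (inj₂ (inj₁ ()))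
¬cycAdj-zero-zero (inj₂ (inj₂ (inj₁ (_ , ()))))
¬cycAdj-zero-zero (inj₂ (inj₂ (inj₂ (_ , ()))))

cycAdj-suc-suc : ∀ {m} {i j : Fin m} → CycAdj (suc m) (suc i) (suc j) ⇔ Consecutive i j
cycAdj-suc-suc = mk⇔ to (⊎-map (cong ℕ.suc) (inj₁ ∘ cong ℕ.suc))
  where
  to : ∀ {m} {i j : Fin m} → CycAdj (suc m) (suc i) (suc j) → Consecutive i j
  to (inj₁ e)                     = inj₁ (ℕ-suc-injective e)
  to (inj₂ (inj₁ e))              = inj₂ (ℕ-suc-injective e)
  to (inj₂ (inj₂ (inj₁ (() , _))))
  to (inj₂ (inj₂ (inj₂ (() , _))))

injective⇒≤∣p∣ : ∀ {m n} {p : Subset n} (g : Fin m → Fin n) →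
                 Injective _≡_ _≡_ g → (∀ i → g i ∈ p) → m ≤ ∣ p ∣
injective⇒≤∣p∣ {ℕ.zero} g inj g∈p = z≤n
injective⇒≤∣p∣ {ℕ.suc m} g inj g∈p =
  ≤-trans (s≤s (injective⇒≤∣p∣ (g ∘ suc) (Fin-suc-injective ∘ inj) g∘suc∈p-g0))
          (x∈p⇒∣p-x∣<∣p∣ (g∈p zero))
  where
  g∘suc∈p-g0 : ∀ i → g (suc i) ∈ _ - g zero
  g∘suc∈p-g0 i = x∈p∧x≢y⇒x∈p-y (g∈p (suc i)) (λ e → 0≢1+n (inj (≡-sym e)))

avoids : ∀ {n} {p q : Subset n} {x} → Empty (p ∩ q) → x ∈ p → x ∉ q
avoids p∩q=∅ x∈p x∈q = p∩q=∅ (_ , x∈p∩q⁺ (x∈p , x∈q))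

module _ {m n : ℕ} {S : Subset n} (A : Fin m → Subset n)
         (disjoint : ∀ {i j x} → x ∈ A i → x ∈ A j → i ≡ j) where

  -- Each member meeting S would give an injection of Fin m into S.
  disjoint-family-avoids : ∣ S ∣ < m → ∃[ i ] Empty (A i ∩ S)
  disjoint-family-avoids ∣S∣<m with ∃? (λ i → ¬? (nonempty? (A i ∩ S)))
  ... | yes found = found
  ... | no none   = contradiction (injective⇒≤∣p∣ witness witness-inj witness∈S) (<⇒≱ ∣S∣<m)
    where
    meets : ∀ i → Nonempty (A i ∩ S)
    meets i = decidable-stable (nonempty? (A i ∩ S)) (λ i-avoids → none (i , i-avoids))
    witness : Fin m → Fin n
    witness i = proj₁ (meets i)
    witness∈A : ∀ i → witness i ∈ A i
    witness∈A i = proj₁ (x∈p∩q⁻ (A i) S (proj₂ (meets i)))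
    witness∈S : ∀ i → witness i ∈ S
    witness∈S i = proj₂ (x∈p∩q⁻ (A i) S (proj₂ (meets i)))
    witness-inj : Injective _≡_ _≡_ witness
    witness-inj {i} {j} e = disjoint (witness∈A i) (subst (_∈ A j) (≡-sym e) (witness∈A j))

disjoint-family-avoids₂ : ∀ {m n} {S : Subset n} (A : Fin m → Subset n) →
  (∀ {i j x} → x ∈ A i → x ∈ A j → i ≡ j) → 2 + ∣ S ∣ ≤ m →
  ∃₂ λ i j → j ≢ i × Empty (A i ∩ S) × Empty (A j ∩ S)
disjoint-family-avoids₂ {ℕ.suc m} A disjoint (s≤s ∣S∣<m)
  with disjoint-family-avoids A disjoint (m<n⇒m<1+n ∣S∣<m)
... | i , Aᵢ-free with disjoint-family-avoids (A ∘ punchIn i)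
                         (λ x∈ x∈′ → punchIn-injective i _ _ (disjoint x∈ x∈′)) ∣S∣<m
... | j , Aⱼ-free = i , punchIn i j , punchInᵢ≢i i j , Aᵢ-free , Aⱼ-free

module Paths {n : ℕ} (G : Graph n) where

  reach-source : ∀ {X a c} → Reach G X a c → X a
  reach-source (here x)     = x
  reach-source (step x _ _) = x

  reach-target : ∀ {X a c} → Reach G X a c → X c
  reach-target (here x)     = x
  reach-target (step _ _ w) = reach-target w

  vertices : ∀ {X a c} → Reach G X a c → List (Fin n)
  vertices (here {u} _)     = u ∷ []
  vertices (step {u} _ _ w) = u ∷ vertices w

  vertices-source : ∀ {X a c} {P : Fin n → Set} → P a → (w : Reach G X a c) → Any P (vertices w)
  vertices-source pa (here _)     = here pa
  vertices-source pa (step _ _ _) = here pa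

  vertices-inside : ∀ {X a c} (w : Reach G X a c) → All X (vertices w)
  vertices-inside (here x)     = x ∷ []
  vertices-inside (step x _ w) = x ∷ vertices-inside w

  reach-within : ∀ {X A a c} → IsComponent G X A → a ∈ A → Reach G X a c → Reach G (_∈ A) a c
  reach-within C a∈A (here _)       = here a∈A
  reach-within C a∈A (step _ a~b w) =
    step a∈A a~b (reach-within C (IsComponent.closed C a∈A (reach-source w) a~b) w)

  component-≡ : ∀ {X A A′ x} → IsComponent G X A → IsComponent G X A′ → x ∈ A → x ∈ A′ → A ≡ A′
  component-≡ C C′ x∈A x∈A′ =
    ⊆-antisym (λ y∈A  → reach-target (reach-within C′ x∈A′ (IsComponent.connected C x∈A y∈A)))
              (λ y∈A′ → reach-target (reach-within C x∈A (IsComponent.connected C′ x∈A′ y∈A′)))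

  components-apart : ∀ {X A A′ x y} → IsComponent G X A → IsComponent G X A′ → A ≢ A′ →
                     x ∈ A → y ∈ A′ → x ≢ y × ¬ Adj G x y
  components-apart C C′ A≢A′ x∈A y∈A′ =
      (λ { refl → A≢A′ (component-≡ C C′ x∈A y∈A′) })
    , (λ x~y → A≢A′ (component-≡ C C′ x∈A
                      (IsComponent.closed C′ y∈A′ (IsComponent.inX C x∈A) (sym G x~y))))

  Detached : Fin n → List (Fin n) → Fin n → Set
  Detached l P x = All (x ≢_) (l ∷ P) × All (¬_ ∘ Adj G x) P

  InducedPath : List (Fin n) → Set
  InducedPath []          = ⊤
  InducedPath (_ ∷ [])    = ⊤
  InducedPath (x ∷ y ∷ P) = Adj G x y × Detached y P x × InducedPath (y ∷ P)

  inducedPath-++⁻ˡ : ∀ xs {ys} → InducedPath (xs ++ ys) → InducedPath xs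
  inducedPath-++⁻ˡ []           _                           = tt
  inducedPath-++⁻ˡ (_ ∷ [])     _                           = tt
  inducedPath-++⁻ˡ (x ∷ y ∷ xs) (x~y , (x≢ , x≁) , induced) =
    x~y , (++⁻ˡ (y ∷ xs) x≢ , ++⁻ˡ xs x≁) , inducedPath-++⁻ˡ (y ∷ xs) induced

  inducedPath-lookup-injective : ∀ {W} → InducedPath W → Injective _≡_ _≡_ (lookup W)
  inducedPath-lookup-injective {_ ∷ []}    _ {zero} {zero} _ = refl
  inducedPath-lookup-injective {_ ∷ _ ∷ _} _ {zero} {zero} _ = refl
  inducedPath-lookup-injective {_ ∷ _ ∷ _} (_ , (x≢ , _) , _) {zero} {suc j} e =
    ⊥-elim (All.lookup x≢ (∈-lookup j) e)
  inducedPath-lookup-injective {_ ∷ _ ∷ _} (_ , (x≢ , _) , _) {suc i} {zero} e =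
    ⊥-elim (All.lookup x≢ (∈-lookup i) (≡-sym e))
  inducedPath-lookup-injective {_ ∷ _ ∷ _} (_ , _ , induced) {suc i} {suc j} e =
    cong suc (inducedPath-lookup-injective induced e)

  inducedPath-adj⇔consecutive : ∀ {W} → InducedPath W → ∀ i j →
                                Adj G (lookup W i) (lookup W j) ⇔ Consecutive i j
  inducedPath-adj⇔consecutive {x ∷ []} _ zero zero = ⇔-⊥ (irrefl G {x}) λ { (inj₁ ()) ; (inj₂ ()) }
  inducedPath-adj⇔consecutive {x ∷ y ∷ P} induced zero j = first⇔ induced j
    where
    first⇔ : InducedPath (x ∷ y ∷ P) → ∀ j → Adj G x (lookup (x ∷ y ∷ P) j) ⇔ Consecutive zero j
    first⇔ _                 zero          = ⇔-⊥ (irrefl G {x}) λ { (inj₁ ()) ; (inj₂ ()) }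
    first⇔ (x~y , _)         (suc zero)    = mk⇔ (λ _ → inj₁ refl) (λ _ → x~y)
    first⇔ (_ , (_ , x≁) , _) (suc (suc j)) =
      ⇔-⊥ (All.lookup x≁ (∈-lookup j)) λ { (inj₁ ()) ; (inj₂ ()) }
  inducedPath-adj⇔consecutive {_ ∷ _ ∷ _} induced (suc i) zero =
    ⇔-trans (mk⇔ (sym G) (sym G))
            (⇔-trans (inducedPath-adj⇔consecutive induced zero (suc i)) (mk⇔ swap swap))
  inducedPath-adj⇔consecutive {_ ∷ _ ∷ _} (_ , _ , induced) (suc i) (suc j) =
    ⇔-trans (inducedPath-adj⇔consecutive induced i j) (⇔-sym consecutive-suc)

  AdjOnlyLast : Fin n → List (Fin n) → Set
  AdjOnlyLast c []          = ⊥
  AdjOnlyLast c (x ∷ [])    = Adj G c x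
  AdjOnlyLast c (x ∷ y ∷ W) = ¬ Adj G c x × AdjOnlyLast c (y ∷ W)

  adjOnlyLast-lookup : ∀ {c} W → AdjOnlyLast c W → ∀ j → Adj G c (lookup W j) ⇔ suc (toℕ j) ≡ length W
  adjOnlyLast-lookup (_ ∷ [])    c~x       zero    = mk⇔ (λ _ → refl) (λ _ → c~x)
  adjOnlyLast-lookup (_ ∷ _ ∷ _) (c≁x , _)  zero    = ⇔-⊥ c≁x λ ()
  adjOnlyLast-lookup (_ ∷ y ∷ W) (_ , last) (suc j) =
    ⇔-trans (adjOnlyLast-lookup (y ∷ W) last j) (mk⇔ (cong ℕ.suc) ℕ-suc-injective)

  adjOnlyLast-∷ : ∀ {c x W} → ¬ Adj G c x → AdjOnlyLast c W → AdjOnlyLast c (x ∷ W)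
  adjOnlyLast-∷ {W = []}    _   ()
  adjOnlyLast-∷ {W = _ ∷ _} c≁x last = c≁x , last

  adjOnlyLast-++ : ∀ {c} H {W} → All (¬_ ∘ Adj G c) H → AdjOnlyLast c W → AdjOnlyLast c (H ++ W)
  adjOnlyLast-++ []      []          last = last
  adjOnlyLast-++ (_ ∷ H) (c≁h ∷ c≁H) last = adjOnlyLast-∷ {W = H ++ _} c≁h (adjOnlyLast-++ H c≁H last)

  inducedPath-end-adjOnlyLast : ∀ {c} x W → InducedPath (x ∷ W ++ [ c ]) → AdjOnlyLast c (x ∷ W)
  inducedPath-end-adjOnlyLast x []      (x~c , _)                 = sym G x~c
  inducedPath-end-adjOnlyLast x (y ∷ W) (_ , (_ , x≁) , induced) =
    (λ c~x → All.head (++⁻ʳ W x≁) (sym G c~x)) , inducedPath-end-adjOnlyLast y W induced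

  chordless-cycle : ∀ {X} c h W → 2 ≤ length W → InducedPath (h ∷ W) → Adj G c h →
                    AdjOnlyLast c W → All (_≢ c) (h ∷ W) → All X (c ∷ h ∷ W) → ChordlessCycle G X
  chordless-cycle c h W 2≤∣W∣ induced c~h last ≢c inside = record
    { len       = length V
    ; len≥4     = s≤s (s≤s 2≤∣W∣)
    ; vert      = lookup V
    ; inj       = injective
    ; inside    = λ i → All.lookup inside (∈-lookup i)
    ; edges     = λ i j → Equivalence.from (adj⇔cycAdj i j)
    ; chordless = λ i j → Equivalence.to (adj⇔cycAdj i j)
    }
    where
    V : List (Fin n)
    V = c ∷ h ∷ W

    centre⇔ : ∀ j → Adj G c (lookup (h ∷ W) j) ⇔ CycAdj (length V) zero (suc j)
    centre⇔ zero    = mk⇔ (λ _ → inj₁ refl) (λ _ → c~h)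
    centre⇔ (suc j) = ⇔-trans (adjOnlyLast-lookup W last j) (mk⇔ to from)
      where
      to : suc (toℕ j) ≡ length W → CycAdj (length V) zero (suc (suc j))
      to e = inj₂ (inj₂ (inj₁ (refl , cong (ℕ.suc ∘ ℕ.suc) e)))
      from : CycAdj (length V) zero (suc (suc j)) → suc (toℕ j) ≡ length W
      from (inj₂ (inj₂ (inj₁ (_ , e)))) = ℕ-suc-injective (ℕ-suc-injective e)
      from (inj₁ ())
      from (inj₂ (inj₁ ()))
      from (inj₂ (inj₂ (inj₂ (() , _))))

    adj⇔cycAdj : ∀ i j → Adj G (lookup V i) (lookup V j) ⇔ CycAdj (length V) i j
    adj⇔cycAdj zero    zero    = ⇔-⊥ (irrefl G) ¬cycAdj-zero-zero
    adj⇔cycAdj zero    (suc j) = centre⇔ j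
    adj⇔cycAdj (suc i) zero    =
      mk⇔ (cycAdj-sym ∘ Equivalence.to (centre⇔ i) ∘ sym G)
          (sym G ∘ Equivalence.from (centre⇔ i) ∘ cycAdj-sym)
    adj⇔cycAdj (suc i) (suc j) =
      ⇔-trans (inducedPath-adj⇔consecutive induced i j) (⇔-sym cycAdj-suc-suc)

    injective : ∀ i j → lookup V i ≡ lookup V j → i ≡ j
    injective zero    zero    _ = refl
    injective zero    (suc j) e = ⊥-elim (All.lookup ≢c (∈-lookup j) (≡-sym e))
    injective (suc i) zero    e = ⊥-elim (All.lookup ≢c (∈-lookup i) e)
    injective (suc i) (suc j) e = cong suc (inducedPath-lookup-injective induced e)

  record InducedPrefix (Src Q : Fin n → Set) (P : List (Fin n)) : Set where
    field
      start      : Fin n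
      middle     : List (Fin n)
      start-src  : Src start
      middle-src : All (¬_ ∘ Src) middle
      inside     : All Q (start ∷ middle)
      induced    : InducedPath (start ∷ middle ++ P)

  open InducedPrefix

  prepend-source : ∀ {Q P b} (R : InducedPrefix (λ x → Adj G x b) Q P) →
                   (∀ {x} → Q x → x ≢ b) → InducedPath (b ∷ start R ∷ middle R)
  prepend-source R ≢b =
      sym G (start-src R)
    , (All.map (≢-sym ∘ ≢b) (inside R) , All.map (λ x≁b b~x → x≁b (sym G b~x)) (middle-src R))
    , inducedPath-++⁻ˡ (start R ∷ middle R) (induced R)

  singleton-prefix : ∀ {Src Q : Fin n → Set} {l P y} → Q y → Src y → Adj G y l → Detached l P y →
                     InducedPath (l ∷ P) → InducedPrefix Src Q (l ∷ P)
  singleton-prefix {y = y} qy sy y~l d path =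
    record { start = y ; middle = [] ; start-src = sy ; middle-src = []
           ; inside = qy ∷ [] ; induced = y~l , d , path }

  -- Shortcutting a walk towards l: the last vertex u adjacent to l before the walk's end
  -- either lies in Src or extends the path to u ∷ l ∷ P.
  induced-prefix : ∀ {Src Q : Fin n → Set} → Decidable Src → ∀ {l P u x} → InducedPath (l ∷ P) →
                   (w : Reach G Q u x) → Src x → Any (λ y → Adj G y l) (vertices w) →
                   All (Detached l P) (vertices w) → InducedPrefix Src Q (l ∷ P)
  induced-prefix Src? path (here qx) sx (here x~l) (d ∷ []) = singleton-prefix qx sx x~l d path
  induced-prefix Src? path (here _) _ (there ()) _
  induced-prefix Src? path (step _ _ w) sx (there later) (_ ∷ ds) =
    induced-prefix Src? path w sx later ds
  induced-prefix {Src} {Q} Src? {l} {P} path (step {u} qu u~w w) sx (here u~l) (d ∷ ds)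
    with Any.any? (λ y → adj-dec G y l) (vertices w)
  ... | yes later = induced-prefix Src? path w sx later ds
  ... | no none with Src? u
  ...   | yes su  = singleton-prefix qu su u~l d path
  ...   | no ¬su  = snoc (induced-prefix Src? (u~l , d , path) w sx
                             (vertices-source (sym G u~w) w)
                             (All.zipWith detach (¬Any⇒All¬ (vertices w) none , ds)))
    where
    detach : ∀ {y} → ¬ Adj G y l × Detached l P y → Detached u (l ∷ P) y
    detach (y≁l , y≢ , y≁) = ((λ { refl → y≁l u~l }) ∷ y≢) , (y≁l ∷ y≁)

    snoc : InducedPrefix Src Q (u ∷ l ∷ P) → InducedPrefix Src Q (l ∷ P)
    snoc R = record
      { start      = start R
      ; middle     = middle R ++ [ u ]
      ; start-src  = start-src R
      ; middle-src = ++⁺ (middle-src R) (¬su ∷ [])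
      ; inside     = ++⁺ (inside R) (qu ∷ [])
      ; induced    = subst (λ M → InducedPath (start R ∷ M))
                           (≡-sym (++-assoc (middle R) [ u ] (l ∷ P))) (induced R)
      }

module FreeCentre {n : ℕ} (G : Graph n) (EI EM : Fin n → Fin n → Set) (v : Fin n) (Bv I : Subset n)
                  (v~I : ∀ {z} → z ∈ I → Adj G v z) (v∉Bv : v ∉ Bv)
                  (S : Subset n) (v∉S : v ∉ S) {b : Fin n} (b∈Bv : b ∈ Bv) (b∉S : b ∉ S) where

  open Setting G EI EM v Bv I
  open Paths G
  open InducedPrefix

  b≢v : b ≢ v
  b≢v refl = v∉Bv b∈Bv

  H-≢v : ∀ {y} → Hset y → y ≢ v
  H-≢v = proj₁

  H-≢b : ∀ {y} → Hset y → y ≢ b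
  H-≢b (_ , y∉Bv , _) refl = y∉Bv b∈Bv

  H∩N[v]⊆I : ∀ {y} → Hset y → Adj G v y → y ∈ I
  H∩N[v]⊆I {y} (_ , y∉Bv , y∉X) v~y = decidable-stable (y ∈? I) (λ y∉I → y∉X (v~y , y∉Bv , y∉I))

  b-to-v : ∀ {A} → InCalA A → NbOfSet b A → InducedPrefix (λ x → Adj G x b) (_∈ A) [ v ]
  b-to-v {A} (C , z , z∈A , z∈I) (a , a∈A , a~b) =
    induced-prefix (λ x → adj-dec G x b) tt walk a~b (vertices-source (sym G (v~I z∈I)) walk)
      (All.map (λ y∈A → (H-≢v (IsComponent.inX C y∈A) ∷ []) , []) (vertices-inside walk))
    where
    walk : Reach G (_∈ A) z a
    walk = reach-within C z∈A (IsComponent.connected C z∈A a∈A)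

  bc-cycle : ∀ {A} → Adj G v b → (∀ z → z ∈ A → z ∈ I → ¬ Adj G z b) → InCalA A → NbOfSet b A →
             Empty (A ∩ S) → ChordlessCycle G (_∉ S)
  bc-cycle v~b b≁I 𝒜A@(C , _) nb A-free with b-to-v 𝒜A nb
  ... | record { start = x ; middle = [] ; start-src = x~b ; inside = x∈A ∷ [] ; induced = x~v , _ } =
    ⊥-elim (b≁I x x∈A (H∩N[v]⊆I (IsComponent.inX C x∈A) (sym G x~v)) x~b)
  ... | R@(record { start = x ; middle = y ∷ ys }) =
    chordless-cycle v b (x ∷ y ∷ ys) (s≤s (s≤s z≤n))
      (prepend-source R (H-≢b ∘ IsComponent.inX C)) v~b
      (inducedPath-end-adjOnlyLast x (y ∷ ys) (induced R))
      (b≢v ∷ All.map (H-≢v ∘ IsComponent.inX C) (inside R))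
      (v∉S ∷ b∉S ∷ All.map (avoids A-free) (inside R))

  bf-cycle : ∀ {A₀ A₁} → ¬ Adj G v b → InCalA A₀ → NbOfSet b A₀ → Empty (A₀ ∩ S) →
             InCalA A₁ → NbOfSet b A₁ → Empty (A₁ ∩ S) → A₁ ≢ A₀ → ChordlessCycle G (_∉ S)
  bf-cycle {A₀} {A₁} v≁b 𝒜₀@(C₀ , _) nb₀ A₀-free (C₁ , z₁ , z₁∈A₁ , z₁∈I) (a₁ , a₁∈A₁ , a₁~b)
           A₁-free A₁≢A₀ =
    chordless-cycle v (start R₁) (middle R₁ ++ b ∷ path₀) length≥2 (induced R₁) (start-src R₁)
      (adjOnlyLast-++ (middle R₁) (middle-src R₁)
        (adjOnlyLast-∷ {W = path₀} v≁b
          (inducedPath-end-adjOnlyLast (start R₀) (middle R₀) (induced R₀))))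
      (++⁺ (All.map (H-≢v ∘ IsComponent.inX C₁) (inside R₁))
           (b≢v ∷ All.map (H-≢v ∘ IsComponent.inX C₀) (inside R₀)))
      (v∉S ∷ ++⁺ (All.map (avoids A₁-free) (inside R₁))
                 (b∉S ∷ All.map (avoids A₀-free) (inside R₀)))
    where
    R₀ : InducedPrefix (λ x → Adj G x b) (_∈ A₀) [ v ]
    R₀ = b-to-v 𝒜₀ nb₀

    path₀ : List (Fin n)
    path₀ = start R₀ ∷ middle R₀

    walk : Reach G (_∈ A₁) a₁ z₁
    walk = reach-within C₁ a₁∈A₁ (IsComponent.connected C₁ a₁∈A₁ z₁∈A₁)

    detached : ∀ {y} → y ∈ A₁ → Detached b path₀ y
    detached {y} y∈A₁ =
        (H-≢b (IsComponent.inX C₁ y∈A₁) ∷ All.map (proj₁ ∘ apart) (inside R₀))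
      , All.map (proj₂ ∘ apart) (inside R₀)
      where
      apart : ∀ {x} → x ∈ A₀ → y ≢ x × ¬ Adj G y x
      apart = components-apart C₁ C₀ A₁≢A₀ y∈A₁

    R₁ : InducedPrefix (Adj G v) (_∈ A₁) (b ∷ path₀)
    R₁ = induced-prefix (adj-dec G v) (prepend-source R₀ (H-≢b ∘ IsComponent.inX C₀)) walk
           (v~I z₁∈I) (vertices-source a₁~b walk) (All.map detached (vertices-inside walk))

    length≥2 : 2 ≤ length (middle R₁ ++ b ∷ path₀)
    length≥2 = subst (2 ≤_) (≡-sym (length-++ (middle R₁)))
                     (≤-trans (s≤s (s≤s z≤n)) (m≤n+m _ (length (middle R₁))))

  module _ {m B* A*} (E : Expansion m HatEdge B* A*) (A*⊆𝒜 : ∀ A → A* A → InCalA A)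
           (b∈B* : b ∈ B*) where

    open Expansion E

    star-component : ∀ i → InCalA (star b b∈B* i)
    star-component i = A*⊆𝒜 _ (star-Q b b∈B* i)

    stars-disjoint : ∀ {i j x} → x ∈ star b b∈B* i → x ∈ star b b∈B* j → i ≡ j
    stars-disjoint {i} {j} x∈i x∈j =
      proj₂ (star-inj b b∈B* i b b∈B* j
              (component-≡ (proj₁ (star-component i)) (proj₁ (star-component j)) x∈i x∈j))

    star-neighbour : ∀ i → NbOfSet b (star b b∈B* i)
    star-neighbour i = [ proj₁ ∘ proj₂ , proj₂ ]′ (star-E b b∈B* i)

    free-centre-cycle : 2 + ∣ S ∣ ≤ m → ChordlessCycle G (_∉ S)
    free-centre-cycle room with disjoint-family-avoids₂ (star b b∈B*) stars-disjoint room
    ... | i , j , j≢i , i-free , j-free with star-E b b∈B* i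
    ...   | inj₁ ((_ , v~b) , nbᵢ , b≁I) = bc-cycle v~b b≁I (star-component i) nbᵢ i-free
    ...   | inj₂ ((_ , v≁b) , nbᵢ)       =
      bf-cycle v≁b (star-component i) nbᵢ i-free (star-component j) (star-neighbour j) j-free
               (j≢i ∘ proj₂ ∘ star-inj b b∈B* j b b∈B* i)

lemma3p12 : {n : ℕ} (G : Graph n) (EI EM : Fin n → Fin n → Set)
            (v : Fin n) (Bv I : Subset n)
            → (∀ u w → EI u w → Adj G u w)
            → (∀ u w → EM u w → Adj G u w)
            → v ∉ Bv
            → ChordalMinus G Bv
            → (∀ u w → u ∈ I → w ∈ I → ¬ Adj G u w)
            → (∀ u → u ∈ I → Setting.NR G EI EM v Bv I v u × u ∉ Bv)
            → (k : ℕ) (Bstar : Subset n) (Astar : Subset n → Set)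
            → Bstar ⊆ Bv
            → (∀ A → Astar A → Setting.InCalA G EI EM v Bv I A)
            → Expansion (k + 2) (Setting.HatEdge G EI EM v Bv I) Bstar Astar
            → (S : Subset n) → ∣ S ∣ ≤ k → v ∉ S → ChordalMinus G S
            → Bstar ⊆ S
lemma3p12 G EI EM v Bv I _ _ v∉Bv _ _ I⊆N[v] k Bstar Astar B*⊆Bv A*⊆𝒜 E S ∣S∣≤k v∉S chordal
          {b} b∈B* =
  decidable-stable (b ∈? S) λ b∉S →
    chordal (FreeCentre.free-centre-cycle G EI EM v Bv I v~I v∉Bv S v∉S (B*⊆Bv b∈B*) b∉S
               E A*⊆𝒜 b∈B* room)
  where
  v~I : ∀ {z} → z ∈ I → Adj G v z
  v~I z∈I = proj₁ (proj₁ (I⊆N[v] _ z∈I))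

  room : 2 + ∣ S ∣ ≤ k + 2
  room = ≤-trans (s≤s (s≤s ∣S∣≤k)) (≤-reflexive (+-comm 2 k))
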